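{- Let $p$ be an odd prime. For any integer $x$, $$\sum_{k=0}^{p-1}D_k(x)^2\equiv\left(\frac{x(x+1)}{p}\right)\pmod p,$$ where $D_n(x)=\sum_{k=0}^n\binom nk\binom{n+k}k x^k$. In particular, with $D_n=D_n(1)=\sum_{k=0}^n\binom nk\binom{n+k}k$ the central Delannoy numbers, $$\sum_{k=0}^{p-1}D_k^2\equiv\left(\frac{2}{p}\right)\pmod p.$$
   Context: $\left(\frac{\cdot}{p}\right)$ denotes the Legendre symbol. -}

module Defs where

open import Data.Nat as ℕ using (ℕ; zero; suc)
open import Data.Nat.Combinatorics using (_C_)
open import Data.Integer as ℤ using (ℤ; +_; -[1+_])

open import Data.List using (List; map; upTo)
open import Data.Bool.ListAction using (any)
open import Data.Bool using (Bool; true; false)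
open import Relation.Nullary.Decidable using (⌊_⌋)

-- Sum_{k=0}^{n} f k  (inclusive upper bound)
Σ≤ : ℕ → (ℕ → ℤ) → ℤ
Σ≤ zero    f = f 0
Σ≤ (suc n) f = Σ≤ n f ℤ.+ f (suc n)

D : ℕ → ℤ → ℤ
D n x = Σ≤ n (λ k → + ((n C k) ℕ.* ((n ℕ.+ k) C k)) ℤ.* (x ℤ.^ k))

-- Legendre symbol (a / p), intended for p an odd prime:
--   0 if p ∣ a, 1 if a is a nonzero square mod p, -1 otherwise.
-- (For p = 0 the value is irrelevant; we return 0.)
legendre : ℤ → ℕ → ℤ
legendre a zero = + 0
legendre a (suc m) with a ℤ.%ℕ (suc m)
... | zero = + 0
... | r@(suc _) with any (λ y → ⌊ (y ℕ.* y) ℕ.% suc m ℕ.≟ r ⌋) (upTo (suc m))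
...   | true  = + 1
...   | false = -[1+ 0 ]

module Submission where

-- Sums of squares of Delannoy polynomials modulo an odd prime p = 2h + 1:
--   Σ_{k<p} D_k(x)² ≡ (x(x+1) / p) (mod p),  D_n(x) = Σ_k C(n,k)·C(n+k,k)·x^k.
--  1. k!²·C(n,k)·C(n+k,k) = P_k(n) with P_k(y) = ∏_{i<k} (y+i+1)(y−i); shift laws of
--     P_k give (n+1)·D_{n+1} + n·D_{n−1} = (2n+1)·t·D_n for t = 2x + 1.
--  2. Hence the self-convolution c_N = Σ_{n≤N} D_n·D_{N−n} obeys the Chebyshev
--     recurrence: c_N = U_{N+1}(t).
--  3. P_k(−1−y) = P_k(y) gives D_n ≡ D_{p−1−n} (mod p), so the sum is ≡ c_{p−1} = U_p(t).
--  4. Frobenius, proved for all commutative semirings, gives in ℤ[√(t²−1)]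
--     U_p(t) ≡ (t²−1)^h = 4^h·(x(x+1))^h, and in ℤ Fermat's little theorem.
--  5. Euler's criterion a^h ≡ (a/p), via Lagrange's bound on the roots of X^h − 1.
-- The file follows this order: binomial coefficients and Frobenius, finite sums,
-- Delannoy and Chebyshev polynomials over ℤ, then congruences modulo p; the theorem
-- corollary1p1 is assembled at the end.

open import Defs
open import Level using (Level; 0ℓ)
open import Algebra.Bundles using (CommutativeSemiring)
open import Data.Nat as ℕ using (ℕ; zero; suc; _∸_; _!; z≤n; s≤s)
import Data.Nat.Properties as ℕP
open import Data.Nat.Combinatorics using (_C_; nC1≡n; nCn≡1; nCk+nC[k+1]≡[n+1]C[k+1]; k>n⇒nCk≡0)
open import Data.Nat.Divisibility using (divides; quotient; >⇒∤; m%n≡0⇒n∣m) renaming (_∣_ to _∣ₙ_)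
open import Data.Nat.DivMod using (m%n<n; m≡m%n+[m/n]*n)
open import Data.Nat.Primality using (Prime; euclidsLemma; ¬prime[1]; composite-≢; prime⇒¬composite; prime⇒nonZero)
open import Data.Nat.Tactic.RingSolver using () renaming (solve-∀ to ℕ-solve)
open import Data.Fin using (Fin; zero; suc; toℕ; inject₁; fromℕ)
import Data.Fin.Properties as FinP
open import Data.Vec.Functional using (Vector; tail)
open import Data.Product using (∃-syntax; _,_; proj₁; proj₂)
open import Data.Sum using (_⊎_; inj₁; inj₂; [_,_]′)
open import Relation.Nullary using (¬_; contradiction)
open import Relation.Binary.PropositionalEquality
  using (_≡_; _≢_; refl; sym; trans; cong; cong₂; subst; isEquivalence; module ≡-Reasoning)

C-absorption : ∀ n k → suc k ℕ.* (suc n C suc k) ≡ suc n ℕ.* (n C k)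
C-absorption zero    zero    = refl
C-absorption zero    (suc k) = ℕP.*-zeroʳ (suc (suc k))
C-absorption (suc n) zero    =
  trans (ℕP.*-identityˡ _) (trans (nC1≡n (suc (suc n))) (sym (ℕP.*-identityʳ (suc (suc n)))))
C-absorption (suc n) (suc k) = begin
  suc K ℕ.* (suc N C suc K)                         ≡⟨ cong (suc K ℕ.*_) (nCk+nC[k+1]≡[n+1]C[k+1] N K) ⟨
  suc K ℕ.* (N C K ℕ.+ N C suc K)                   ≡⟨ split (N C K) (N C suc K) k ⟩
  N C K ℕ.+ K ℕ.* (N C K) ℕ.+ suc K ℕ.* (N C suc K) ≡⟨ cong₂ (λ a b → N C K ℕ.+ a ℕ.+ b) (C-absorption n k) (C-absorption n K) ⟩
  N C K ℕ.+ N ℕ.* (n C k) ℕ.+ N ℕ.* (n C K)         ≡⟨ ℕP.+-assoc (N C K) _ _ ⟩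
  N C K ℕ.+ (N ℕ.* (n C k) ℕ.+ N ℕ.* (n C K))       ≡⟨ cong (N C K ℕ.+_) (ℕP.*-distribˡ-+ N (n C k) (n C K)) ⟨
  N C K ℕ.+ N ℕ.* (n C k ℕ.+ n C K)                 ≡⟨ cong (λ c → N C K ℕ.+ N ℕ.* c) (nCk+nC[k+1]≡[n+1]C[k+1] n k) ⟩
  suc N ℕ.* (N C K)                                 ∎
  where
  open ≡-Reasoning
  N = suc n
  K = suc k
  split : ∀ a b k → suc (suc k) ℕ.* (a ℕ.+ b) ≡ a ℕ.+ suc k ℕ.* a ℕ.+ suc (suc k) ℕ.* b
  split = ℕ-solve

-- A prime p divides the binomial coefficients C(p,k) with 0 < k < p:
-- k·C(p,k) = p·C(p−1,k−1) by absorption, and p ∤ k.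
prime∣choose : ∀ {p k} → Prime p → 0 ℕ.< k → k ℕ.< p → p ∣ₙ p C k
prime∣choose {suc p′} {suc k′} isPrime _ k<p
  with euclidsLemma (suc k′) (suc p′ C suc k′) isPrime (divides (p′ C k′) (trans (C-absorption p′ k′) (ℕP.*-comm (suc p′) _)))
... | inj₁ p∣k = contradiction p∣k (>⇒∤ k<p)
... | inj₂ p∣C = p∣C

-- Frobenius: in any commutative semiring (x + y)^p and x^p + y^p differ by
-- a p-fold multiple p × r, because all inner binomial coefficients of
-- (x + y)^p are divisible by p.
module Frobenius {c ℓ : Level} (S : CommutativeSemiring c ℓ) where

  open CommutativeSemiring S hiding (zero) renaming (refl to ≈-refl; sym to ≈-sym; trans to ≈-trans)
  open import Algebra.Properties.CommutativeSemiring.Binomial S using (theorem; binomialTerm)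
  open import Algebra.Properties.Semiring.Exp semiring using (_^_; ^-congʳ)
  open import Algebra.Properties.CommutativeMonoid.Mult +-commutativeMonoid
    using (_×_; ×-distrib-+; ×-assocˡ; ×-cong; ×-homo-1)
  open import Algebra.Properties.Monoid.Sum +-monoid using (sum; sum-init-last; sum-cong-≋)
  open import Relation.Binary.Reasoning.Setoid setoid

  ×-zeroʳ : ∀ m → m × 0# ≈ 0#
  ×-zeroʳ zero    = ≈-refl
  ×-zeroʳ (suc m) = ≈-trans (+-congˡ (×-zeroʳ m)) (+-identityˡ 0#)

  ×-distrib-sum : ∀ {n} m (f : Vector Carrier n) → sum (λ i → m × f i) ≈ m × sum f
  ×-distrib-sum {zero}  m f = ≈-sym (×-zeroʳ m)
  ×-distrib-sum {suc n} m f =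
    ≈-trans (+-congˡ (×-distrib-sum m (tail f))) (≈-sym (×-distrib-+ (f zero) (sum (tail f)) m))

  ×-factor : ∀ {p m} (p∣m : p ∣ₙ m) b → m × b ≈ p × (quotient p∣m × b)
  ×-factor {p} (divides q refl) b = ≈-trans (×-cong (ℕP.*-comm q p) ≈-refl) (≈-sym (×-assocˡ b p q))

  frobenius : ∀ {p} → Prime p → ∀ x y → ∃[ r ] (x + y) ^ p ≈ x ^ p + y ^ p + p × r
  frobenius {p@(suc (suc q))} isPrime x y = sum reduced , (begin
    (x + y) ^ p                                    ≈⟨ theorem p x y ⟩
    first + sum (λ i → binomialTerm x y p (suc i)) ≈⟨ +-congˡ (sum-init-last (λ i → binomialTerm x y p (suc i))) ⟩
    first + (sum inner + last)                     ≈⟨ +-cong first≈ (+-cong inner≈ last≈) ⟩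
    y ^ p + (p × sum reduced + x ^ p)              ≈⟨ rearrange (y ^ p) (p × sum reduced) (x ^ p) ⟩
    x ^ p + y ^ p + p × sum reduced                ∎)
    where
    first = binomialTerm x y p zero
    last  = binomialTerm x y p (suc (fromℕ (suc q)))

    -- The terms C(p,k) x^k y^(p−k) with 0 < k < p.
    index : Fin (suc q) → ℕ
    index i = suc (toℕ (inject₁ i))
    index<p : ∀ i → index i ℕ.< p
    index<p i = s≤s (subst (ℕ._< suc q) (sym (FinP.toℕ-inject₁ i)) (FinP.toℕ<n i))
    monomial : Fin (suc q) → Carrier
    monomial i = x ^ index i * y ^ (p ∸ index i)
    inner : Fin (suc q) → Carrier
    inner i = binomialTerm x y p (suc (inject₁ i))
    p∣C : ∀ i → p ∣ₙ p C index i
    p∣C i = prime∣choose isPrime (s≤s z≤n) (index<p i)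
    reduced : Fin (suc q) → Carrier
    reduced i = quotient (p∣C i) × monomial i

    first≈ : first ≈ y ^ p
    first≈ = ≈-trans (×-homo-1 _) (*-identityˡ _)

    inner≈ : sum inner ≈ p × sum reduced
    inner≈ = ≈-trans (sum-cong-≋ (λ i → ×-factor (p∣C i) (monomial i))) (×-distrib-sum p reduced)

    last≈ : last ≈ x ^ p
    last≈ = begin
      (p C k) × (x ^ k * y ^ (p ∸ k)) ≈⟨ ×-cong (cong (p C_) k≡p) (*-cong (^-congʳ x k≡p) (^-congʳ y (cong (p ∸_) k≡p))) ⟩
      (p C p) × (x ^ p * y ^ (p ∸ p)) ≈⟨ ×-cong (nCn≡1 p) (*-congˡ (^-congʳ y (ℕP.n∸n≡0 p))) ⟩
      1 × (x ^ p * 1#)                ≈⟨ ×-homo-1 _ ⟩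
      x ^ p * 1#                      ≈⟨ *-identityʳ _ ⟩
      x ^ p                           ∎
      where
      k = toℕ (suc (fromℕ (suc q)))
      k≡p : k ≡ p
      k≡p = cong suc (FinP.toℕ-fromℕ (suc q))

    rearrange : ∀ a m b → a + (m + b) ≈ b + a + m
    rearrange a m b = begin
      a + (m + b) ≈⟨ +-congˡ (+-comm m b) ⟩
      a + (b + m) ≈⟨ +-assoc a b m ⟨
      (a + b) + m ≈⟨ +-congʳ (+-comm a b) ⟩
      b + a + m   ∎

open import Algebra.Structures.Biased using (isCommutativeSemiringˡ)
open import Data.Integer as ℤ using (ℤ; +_; -[1+_]; _+_; _*_; _-_; -_; _^_; ∣_∣)
import Data.Integer.Properties as ℤP
open import Data.Integer.DivMod using (a≡a%ℕn+[a/ℕn]*n; n%ℕd<d)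
open import Data.Integer.Divisibility using (_∣_)
import Data.Integer.Divisibility.Signed as Signed
open import Data.Integer.Tactic.RingSolver using (solve-∀)
open import Data.Product using (_×_)
open import Data.Bool using (Bool; true; false; T)
open import Data.Bool.ListAction using (any)
open import Data.Unit using (tt)
open import Data.Empty using (⊥; ⊥-elim)
open import Data.List using (List; []; _∷_; length; replicate; upTo)
open import Data.List.Properties using (length-replicate)
open import Data.List.Relation.Unary.All as All using (All; []; _∷_)
open import Data.List.Relation.Unary.AllPairs using (AllPairs; []; _∷_)
open import Data.List.Relation.Unary.Any as Any using (Any)
open import Data.List.Relation.Unary.Any.Properties using (any⁺; any⁻)
open import Data.List.Membership.Propositional using (lose)
open import Data.List.Membership.Propositional.Properties using (∈-upTo⁺)
open import Relation.Nullary.Decidable using (⌊_⌋; toWitness; fromWitness)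
open import Relation.Binary.Bundles using (Setoid)
open import Relation.Binary.Definitions using (tri<; tri≈; tri>)
import Relation.Binary.Reasoning.Setoid

Σ≤-cong : ∀ N {f g : ℕ → ℤ} → (∀ k → k ℕ.≤ N → f k ≡ g k) → Σ≤ N f ≡ Σ≤ N g
Σ≤-cong zero    f≡g = f≡g 0 z≤n
Σ≤-cong (suc N) f≡g =
  cong₂ _+_ (Σ≤-cong N (λ k k≤N → f≡g k (ℕP.m≤n⇒m≤1+n k≤N))) (f≡g (suc N) ℕP.≤-refl)

Σ≤-+ : ∀ N (f g : ℕ → ℤ) → Σ≤ N (λ k → f k + g k) ≡ Σ≤ N f + Σ≤ N g
Σ≤-+ zero    f g = refl
Σ≤-+ (suc N) f g rewrite Σ≤-+ N f g = interchange (Σ≤ N f) (Σ≤ N g) (f (suc N)) (g (suc N))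
  where
  interchange : ∀ a b c d → a + b + (c + d) ≡ a + c + (b + d)
  interchange = solve-∀

Σ≤-*ˡ : ∀ N c (f : ℕ → ℤ) → Σ≤ N (λ k → c * f k) ≡ c * Σ≤ N f
Σ≤-*ˡ zero    c f = refl
Σ≤-*ˡ (suc N) c f rewrite Σ≤-*ˡ N c f = sym (ℤP.*-distribˡ-+ c (Σ≤ N f) (f (suc N)))

Σ≤-shift : ∀ N (f : ℕ → ℤ) → Σ≤ (suc N) f ≡ f 0 + Σ≤ N (λ k → f (suc k))
Σ≤-shift zero    f = refl
Σ≤-shift (suc N) f rewrite Σ≤-shift N f = ℤP.+-assoc (f 0) _ _

Σ≤-pad : ∀ {n N} (f : ℕ → ℤ) → n ℕ.≤ N → (∀ k → n ℕ.< k → f k ≡ + 0) → Σ≤ N f ≡ Σ≤ n f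
Σ≤-pad {n} f n≤N vanish with ℕP.m≤n⇒∃[o]m+o≡n n≤N
... | d , refl = go d
  where
  go : ∀ d → Σ≤ (n ℕ.+ d) f ≡ Σ≤ n f
  go zero    rewrite ℕP.+-identityʳ n = refl
  go (suc d) rewrite ℕP.+-suc n d | go d | vanish (suc (n ℕ.+ d)) (s≤s (ℕP.m≤m+n n d)) =
    ℤP.+-identityʳ (Σ≤ n f)

Σ≤-reverse : ∀ N (f : ℕ → ℤ) → Σ≤ N f ≡ Σ≤ N (λ k → f (N ∸ k))
Σ≤-reverse zero    f = refl
Σ≤-reverse (suc N) f = begin
  Σ≤ N f + f (suc N)                 ≡⟨ cong (_+ f (suc N)) (Σ≤-reverse N f) ⟩
  Σ≤ N (λ k → f (N ∸ k)) + f (suc N) ≡⟨ ℤP.+-comm _ (f (suc N)) ⟩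
  f (suc N) + Σ≤ N (λ k → f (N ∸ k)) ≡⟨ Σ≤-shift N (λ k → f (suc N ∸ k)) ⟨
  Σ≤ (suc N) (λ k → f (suc N ∸ k))   ∎
  where open ≡-Reasoning

pos-suc : ∀ n → + suc n ≡ + n + + 1
pos-suc n = trans (ℤP.pos-+ 1 n) (ℤP.+-comm (+ 1) (+ n))

C-lower : ∀ n k → + suc k * + (n C suc k) ≡ (+ n - + k) * + (n C k)
C-lower n k = begin
  + suc k * B′                               ≡⟨ isolate (+ suc k * B′) (+ suc k * B) ⟩
  (+ suc k * B′ + + suc k * B) - + suc k * B ≡⟨ cong (_- + suc k * B) lifted ⟩
  + suc n * B - + suc k * B                  ≡⟨ cong₂ (λ a b → a * B - b * B) (pos-suc n) (pos-suc k) ⟩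
  (+ n + + 1) * B - (+ k + + 1) * B          ≡⟨ collect (+ n) (+ k) B ⟩
  (+ n - + k) * B                            ∎
  where
  open ≡-Reasoning
  B = + (n C k)
  B′ = + (n C suc k)
  pascal-absorption : suc k ℕ.* (n C suc k) ℕ.+ suc k ℕ.* (n C k) ≡ suc n ℕ.* (n C k)
  pascal-absorption = begin
    suc k ℕ.* (n C suc k) ℕ.+ suc k ℕ.* (n C k) ≡⟨ ℕP.+-comm (suc k ℕ.* (n C suc k)) _ ⟩
    suc k ℕ.* (n C k) ℕ.+ suc k ℕ.* (n C suc k) ≡⟨ ℕP.*-distribˡ-+ (suc k) (n C k) (n C suc k) ⟨
    suc k ℕ.* (n C k ℕ.+ n C suc k)             ≡⟨ cong (suc k ℕ.*_) (nCk+nC[k+1]≡[n+1]C[k+1] n k) ⟩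
    suc k ℕ.* (suc n C suc k)                   ≡⟨ C-absorption n k ⟩
    suc n ℕ.* (n C k)                           ∎
  lifted : + suc k * B′ + + suc k * B ≡ + suc n * B
  lifted = begin
    + suc k * B′ + + suc k * B                        ≡⟨ cong₂ _+_ (ℤP.pos-* (suc k) (n C suc k)) (ℤP.pos-* (suc k) (n C k)) ⟨
    + (suc k ℕ.* (n C suc k)) + + (suc k ℕ.* (n C k)) ≡⟨ ℤP.pos-+ (suc k ℕ.* (n C suc k)) _ ⟨
    + (suc k ℕ.* (n C suc k) ℕ.+ suc k ℕ.* (n C k))   ≡⟨ cong +_ pascal-absorption ⟩
    + (suc n ℕ.* (n C k))                             ≡⟨ ℤP.pos-* (suc n) (n C k) ⟩
    + suc n * B                                       ∎
  isolate : ∀ a b → a ≡ (a + b) - b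
  isolate = solve-∀
  collect : ∀ n k b → (n + + 1) * b - (k + + 1) * b ≡ (n - k) * b
  collect = solve-∀

coeff : ℕ → ℕ → ℤ
coeff n k = + ((n C k) ℕ.* ((n ℕ.+ k) C k))

coeff-vanish : ∀ {n k} → n ℕ.< k → coeff n k ≡ + 0
coeff-vanish {n} {k} n<k rewrite k>n⇒nCk≡0 n<k = refl

coeff-step : ∀ n k → (+ suc k * + suc k) * coeff n (suc k)
                   ≡ ((+ n + + k + + 1) * (+ n - + k)) * coeff n k
coeff-step n k = begin
  (+ suc k * + suc k) * coeff n (suc k)
    ≡⟨ cong (λ m → (+ suc k * + suc k) * + ((n C suc k) ℕ.* (m C suc k))) (ℕP.+-suc n k) ⟩
  (+ suc k * + suc k) * + ((n C suc k) ℕ.* L)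
    ≡⟨ cong ((+ suc k * + suc k) *_) (ℤP.pos-* (n C suc k) L) ⟩
  (+ suc k * + suc k) * (+ (n C suc k) * + L)
    ≡⟨ regroup (+ suc k) (+ (n C suc k)) (+ L) ⟩
  (+ suc k * + (n C suc k)) * (+ suc k * + L)
    ≡⟨ cong₂ _*_ (C-lower n k) upper ⟩
  ((+ n - + k) * + (n C k)) * ((+ n + + k + + 1) * + ((n ℕ.+ k) C k))
    ≡⟨ regroup′ (+ n - + k) (+ (n C k)) (+ n + + k + + 1) (+ ((n ℕ.+ k) C k)) ⟩
  ((+ n + + k + + 1) * (+ n - + k)) * (+ (n C k) * + ((n ℕ.+ k) C k))
    ≡⟨ cong (((+ n + + k + + 1) * (+ n - + k)) *_) (ℤP.pos-* (n C k) ((n ℕ.+ k) C k)) ⟨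
  ((+ n + + k + + 1) * (+ n - + k)) * coeff n k ∎
  where
  open ≡-Reasoning
  L = suc (n ℕ.+ k) C suc k
  upper : + suc k * + L ≡ (+ n + + k + + 1) * + ((n ℕ.+ k) C k)
  upper = begin
    + suc k * + L                         ≡⟨ ℤP.pos-* (suc k) L ⟨
    + (suc k ℕ.* L)                       ≡⟨ cong +_ (C-absorption (n ℕ.+ k) k) ⟩
    + (suc (n ℕ.+ k) ℕ.* ((n ℕ.+ k) C k)) ≡⟨ ℤP.pos-* (suc (n ℕ.+ k)) _ ⟩
    + suc (n ℕ.+ k) * + ((n ℕ.+ k) C k)   ≡⟨ cong (_* + ((n ℕ.+ k) C k)) (trans (pos-suc (n ℕ.+ k)) (cong (_+ + 1) (ℤP.pos-+ n k))) ⟩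
    (+ n + + k + + 1) * + ((n ℕ.+ k) C k) ∎
  regroup : ∀ s a b → (s * s) * (a * b) ≡ (s * a) * (s * b)
  regroup = solve-∀
  regroup′ : ∀ d a s b → (d * a) * (s * b) ≡ (s * d) * (a * b)
  regroup′ = solve-∀

-- It is k!² times the coefficient a(n,k) at y = n (coeff-product), and it
-- satisfies simple shift and reflection laws in y, which is where the
-- arithmetic of the Delannoy polynomials comes from.
pairProduct : ℕ → ℤ → ℤ
pairProduct zero    y = + 1
pairProduct (suc k) y = pairProduct k y * ((y + + k + + 1) * (y - + k))

factorial² : ℕ → ℤ
factorial² k = + (k ! ℕ.* k !)

factorial²-suc : ∀ k → factorial² (suc k) ≡ (+ suc k * + suc k) * factorial² k
factorial²-suc k = begin
  + ((suc k ℕ.* k !) ℕ.* (suc k ℕ.* k !))   ≡⟨ ℤP.pos-* (suc k ℕ.* k !) _ ⟩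
  + (suc k ℕ.* k !) * + (suc k ℕ.* k !)     ≡⟨ cong₂ _*_ (ℤP.pos-* (suc k) (k !)) (ℤP.pos-* (suc k) (k !)) ⟩
  (+ suc k * + (k !)) * (+ suc k * + (k !)) ≡⟨ regroup (+ suc k) (+ (k !)) ⟩
  (+ suc k * + suc k) * (+ (k !) * + (k !)) ≡⟨ cong ((+ suc k * + suc k) *_) (ℤP.pos-* (k !) (k !)) ⟨
  (+ suc k * + suc k) * factorial² k        ∎
  where
  open ≡-Reasoning
  regroup : ∀ s f → (s * f) * (s * f) ≡ (s * s) * (f * f)
  regroup = solve-∀

coeff-product : ∀ n k → factorial² k * coeff n k ≡ pairProduct k (+ n)
coeff-product n zero    = refl
coeff-product n (suc k) = begin
  factorial² (suc k) * coeff n (suc k)                           ≡⟨ cong (_* coeff n (suc k)) (factorial²-suc k) ⟩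
  ((+ suc k * + suc k) * factorial² k) * coeff n (suc k)         ≡⟨ swap (+ suc k * + suc k) (factorial² k) (coeff n (suc k)) ⟩
  factorial² k * ((+ suc k * + suc k) * coeff n (suc k))         ≡⟨ cong (factorial² k *_) (coeff-step n k) ⟩
  factorial² k * (((+ n + + k + + 1) * (+ n - + k)) * coeff n k) ≡⟨ swap′ (factorial² k) _ (coeff n k) ⟩
  (factorial² k * coeff n k) * ((+ n + + k + + 1) * (+ n - + k)) ≡⟨ cong (_* ((+ n + + k + + 1) * (+ n - + k))) (coeff-product n k) ⟩
  pairProduct (suc k) (+ n)                                      ∎
  where
  open ≡-Reasoning
  swap : ∀ a b c → (a * b) * c ≡ b * (a * c)
  swap = solve-∀
  swap′ : ∀ a b c → a * (b * c) ≡ (a * c) * b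
  swap′ = solve-∀

pairProduct-up : ∀ k y → pairProduct (suc k) (y + + 1) ≡ pairProduct k y * ((y + + k + + 1) * (y + + k + + 2))
pairProduct-up zero    y = step y
  where
  step : ∀ y → + 1 * ((y + + 1 + + 0 + + 1) * (y + + 1 - + 0)) ≡ + 1 * ((y + + 0 + + 1) * (y + + 0 + + 2))
  step = solve-∀
pairProduct-up (suc k) y = begin
  pairProduct (suc k) (y + + 1) * ((y + + 1 + + suc k + + 1) * (y + + 1 - + suc k))
    ≡⟨ cong₂ (λ P s → P * ((y + + 1 + s + + 1) * (y + + 1 - s))) (pairProduct-up k y) (pos-suc k) ⟩
  pairProduct k y * ((y + + k + + 1) * (y + + k + + 2)) * ((y + + 1 + (+ k + + 1) + + 1) * (y + + 1 - (+ k + + 1)))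
    ≡⟨ step (pairProduct k y) y (+ k) ⟩
  pairProduct (suc k) y * ((y + (+ k + + 1) + + 1) * (y + (+ k + + 1) + + 2))
    ≡⟨ cong (λ s → pairProduct (suc k) y * ((y + s + + 1) * (y + s + + 2))) (pos-suc k) ⟨
  pairProduct (suc k) y * ((y + + suc k + + 1) * (y + + suc k + + 2)) ∎
  where
  open ≡-Reasoning
  step : ∀ P y k → P * ((y + k + + 1) * (y + k + + 2)) * ((y + + 1 + (k + + 1) + + 1) * (y + + 1 - (k + + 1)))
                 ≡ P * ((y + k + + 1) * (y - k)) * ((y + (k + + 1) + + 1) * (y + (k + + 1) + + 2))
  step = solve-∀

pairProduct-down : ∀ k y → pairProduct (suc k) (y - + 1) ≡ pairProduct k y * ((y - + k - + 1) * (y - + k))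
pairProduct-down zero    y = step y
  where
  step : ∀ y → + 1 * ((y - + 1 + + 0 + + 1) * (y - + 1 - + 0)) ≡ + 1 * ((y - + 0 - + 1) * (y - + 0))
  step = solve-∀
pairProduct-down (suc k) y = begin
  pairProduct (suc k) (y - + 1) * ((y - + 1 + + suc k + + 1) * (y - + 1 - + suc k))
    ≡⟨ cong₂ (λ P s → P * ((y - + 1 + s + + 1) * (y - + 1 - s))) (pairProduct-down k y) (pos-suc k) ⟩
  pairProduct k y * ((y - + k - + 1) * (y - + k)) * ((y - + 1 + (+ k + + 1) + + 1) * (y - + 1 - (+ k + + 1)))
    ≡⟨ step (pairProduct k y) y (+ k) ⟩
  pairProduct (suc k) y * ((y - (+ k + + 1) - + 1) * (y - (+ k + + 1)))
    ≡⟨ cong (λ s → pairProduct (suc k) y * ((y - s - + 1) * (y - s))) (pos-suc k) ⟨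
  pairProduct (suc k) y * ((y - + suc k - + 1) * (y - + suc k)) ∎
  where
  open ≡-Reasoning
  step : ∀ P y k → P * ((y - k - + 1) * (y - k)) * ((y - + 1 + (k + + 1) + + 1) * (y - + 1 - (k + + 1)))
                 ≡ P * ((y + k + + 1) * (y - k)) * ((y - (k + + 1) - + 1) * (y - (k + + 1)))
  step = solve-∀

pairProduct-reflect : ∀ k y → pairProduct k (- y - + 1) ≡ pairProduct k y
pairProduct-reflect zero    y = refl
pairProduct-reflect (suc k) y rewrite pairProduct-reflect k y = step (pairProduct k y) y (+ k)
  where
  step : ∀ P y k → P * ((- y - + 1 + k + + 1) * (- y - + 1 - k)) ≡ P * ((y + k + + 1) * (y - k))
  step = solve-∀

pairProductBelow : ℕ → ℤ → ℤ
pairProductBelow zero    y = + 0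
pairProductBelow (suc k) y = (+ k + + 1) * (+ k + + 1) * pairProduct k y

pairProduct-recurrence : ∀ k y → (y + + 1) * pairProduct k (y + + 1) + y * pairProduct k (y - + 1)
                                ≡ (y + y + + 1) * (pairProduct k y + + 2 * pairProductBelow k y)
pairProduct-recurrence zero    y = identity y
  where
  identity : ∀ y → (y + + 1) * + 1 + y * + 1 ≡ (y + y + + 1) * (+ 1 + + 2 * + 0)
  identity = solve-∀
pairProduct-recurrence (suc k) y = begin
  (y + + 1) * pairProduct (suc k) (y + + 1) + y * pairProduct (suc k) (y - + 1)
    ≡⟨ cong₂ (λ a b → (y + + 1) * a + y * b) (pairProduct-up k y) (pairProduct-down k y) ⟩
  (y + + 1) * (pairProduct k y * ((y + + k + + 1) * (y + + k + + 2)))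
    + y * (pairProduct k y * ((y - + k - + 1) * (y - + k)))
    ≡⟨ identity (pairProduct k y) y (+ k) ⟩
  (y + y + + 1) * (pairProduct k y * ((y + + k + + 1) * (y - + k)) + + 2 * pairProductBelow (suc k) y) ∎
  where
  open ≡-Reasoning
  identity : ∀ P y k → (y + + 1) * (P * ((y + k + + 1) * (y + k + + 2))) + y * (P * ((y - k - + 1) * (y - k)))
                     ≡ (y + y + + 1) * (P * ((y + k + + 1) * (y - k)) + + 2 * ((k + + 1) * (k + + 1) * P))
  identity = solve-∀

-- a(n,k−1), with the value 0 for k = 0: the coefficients of x·D_n(x).
coeffBelow : ℕ → ℕ → ℤ
coeffBelow n zero    = + 0
coeffBelow n (suc k) = coeff n k

coeffBelow-product : ∀ n k → factorial² k * coeffBelow n k ≡ pairProductBelow k (+ n)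
coeffBelow-product n zero    = refl
coeffBelow-product n (suc k) = begin
  factorial² (suc k) * coeff n k                   ≡⟨ cong (_* coeff n k) (factorial²-suc k) ⟩
  (+ suc k * + suc k) * factorial² k * coeff n k   ≡⟨ ℤP.*-assoc (+ suc k * + suc k) (factorial² k) (coeff n k) ⟩
  (+ suc k * + suc k) * (factorial² k * coeff n k) ≡⟨ cong₂ (λ s P → (s * s) * P) (pos-suc k) (coeff-product n k) ⟩
  pairProductBelow (suc k) (+ n)                   ∎
  where open ≡-Reasoning

-- n·k!²·a(n−1,k) = n·P_k(n−1); for n = 0 both sides vanish.
coeff-pred-product : ∀ n k → + n * (factorial² k * coeff (ℕ.pred n) k) ≡ + n * pairProduct k (+ n - + 1)
coeff-pred-product zero    k = refl
coeff-pred-product (suc m) k = cong (+ suc m *_) (trans (coeff-product m k) (cong (pairProduct k) predecessor))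
  where
  predecessor : + m ≡ + suc m - + 1
  predecessor = trans (cancel (+ m)) (cong (_- + 1) (sym (pos-suc m)))
    where
    cancel : ∀ a → a ≡ (a + + 1) - + 1
    cancel = solve-∀

coeff-recurrence : ∀ n k → + suc n * coeff (suc n) k + + n * coeff (ℕ.pred n) k
                         ≡ (+ n + + n + + 1) * (coeff n k + + 2 * coeffBelow n k)
coeff-recurrence n k = ℤP.*-cancelˡ-≡ (factorial² k) _ _ {{factorial²≢0}} (begin
  F * (+ suc n * coeff (suc n) k + + n * coeff (ℕ.pred n) k)
    ≡⟨ distribute F (+ suc n) (+ n) (coeff (suc n) k) (coeff (ℕ.pred n) k) ⟩
  + suc n * (F * coeff (suc n) k) + + n * (F * coeff (ℕ.pred n) k)
    ≡⟨ cong₂ _+_ (cong (+ suc n *_) (coeff-product (suc n) k)) (coeff-pred-product n k) ⟩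
  + suc n * pairProduct k (+ suc n) + + n * pairProduct k (+ n - + 1)
    ≡⟨ cong (λ y → y * pairProduct k y + + n * pairProduct k (+ n - + 1)) (pos-suc n) ⟩
  (+ n + + 1) * pairProduct k (+ n + + 1) + + n * pairProduct k (+ n - + 1)
    ≡⟨ pairProduct-recurrence k (+ n) ⟩
  (+ n + + n + + 1) * (pairProduct k (+ n) + + 2 * pairProductBelow k (+ n))
    ≡⟨ cong₂ (λ a b → (+ n + + n + + 1) * (a + + 2 * b)) (coeff-product n k) (coeffBelow-product n k) ⟨
  (+ n + + n + + 1) * (F * coeff n k + + 2 * (F * coeffBelow n k))
    ≡⟨ factor F (+ n + + n + + 1) (coeff n k) (coeffBelow n k) ⟩
  F * ((+ n + + n + + 1) * (coeff n k + + 2 * coeffBelow n k)) ∎)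
  where
  open ≡-Reasoning
  F = factorial² k
  factorial²≢0 : ℤ.NonZero F
  factorial²≢0 = ℕP.m*n≢0 (k !) (k !) {{ℕP._!≢0 k}} {{ℕP._!≢0 k}}
  distribute : ∀ F s n a b → F * (s * a + n * b) ≡ s * (F * a) + n * (F * b)
  distribute = solve-∀
  factor : ∀ F c a b → c * (F * a + + 2 * (F * b)) ≡ F * (c * (a + + 2 * b))
  factor = solve-∀

D-padded : ∀ {n N} x → n ℕ.≤ N → Σ≤ N (λ k → coeff n k * x ^ k) ≡ D n x
D-padded {n} x n≤N = Σ≤-pad _ n≤N (λ k n<k → trans (cong (_* x ^ k) (coeff-vanish n<k)) (ℤP.*-zeroˡ (x ^ k)))

xD-expansion : ∀ n x → Σ≤ (suc n) (λ k → coeffBelow n k * x ^ k) ≡ x * D n x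
xD-expansion n x = begin
  Σ≤ (suc n) (λ k → coeffBelow n k * x ^ k)        ≡⟨ Σ≤-shift n _ ⟩
  + 0 * + 1 + Σ≤ n (λ k → coeff n k * (x * x ^ k)) ≡⟨ ℤP.+-identityˡ _ ⟩
  Σ≤ n (λ k → coeff n k * (x * x ^ k))             ≡⟨ Σ≤-cong n (λ k _ → swap (coeff n k) x (x ^ k)) ⟩
  Σ≤ n (λ k → x * (coeff n k * x ^ k))             ≡⟨ Σ≤-*ˡ n x _ ⟩
  x * D n x                                        ∎
  where
  open ≡-Reasoning
  swap : ∀ a x y → a * (x * y) ≡ x * (a * y)
  swap = solve-∀

D-recurrence : ∀ n x → + suc n * D (suc n) x + + n * D (ℕ.pred n) x
                     ≡ (+ n + + n + + 1) * ((+ 2 * x + + 1) * D n x)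
D-recurrence n x = begin
  + suc n * D (suc n) x + + n * D (ℕ.pred n) x
    ≡⟨ cong (λ d → + suc n * D (suc n) x + + n * d) (D-padded x pred≤N) ⟨
  + suc n * Σ≤ N (λ k → coeff (suc n) k * x ^ k) + + n * Σ≤ N (λ k → coeff (ℕ.pred n) k * x ^ k)
    ≡⟨ cong₂ _+_ (Σ≤-*ˡ N (+ suc n) _) (Σ≤-*ˡ N (+ n) _) ⟨
  Σ≤ N (λ k → + suc n * (coeff (suc n) k * x ^ k)) + Σ≤ N (λ k → + n * (coeff (ℕ.pred n) k * x ^ k))
    ≡⟨ Σ≤-+ N _ _ ⟨
  Σ≤ N (λ k → + suc n * (coeff (suc n) k * x ^ k) + + n * (coeff (ℕ.pred n) k * x ^ k))
    ≡⟨ Σ≤-cong N (λ k _ → termwise k) ⟩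
  Σ≤ N (λ k → c * (coeff n k * x ^ k) + c * (+ 2 * (coeffBelow n k * x ^ k)))
    ≡⟨ Σ≤-+ N _ _ ⟩
  Σ≤ N (λ k → c * (coeff n k * x ^ k)) + Σ≤ N (λ k → c * (+ 2 * (coeffBelow n k * x ^ k)))
    ≡⟨ cong₂ _+_ (Σ≤-*ˡ N c _) (trans (Σ≤-*ˡ N c _) (cong (c *_) (Σ≤-*ˡ N (+ 2) _))) ⟩
  c * Σ≤ N (λ k → coeff n k * x ^ k) + c * (+ 2 * Σ≤ N (λ k → coeffBelow n k * x ^ k))
    ≡⟨ cong₂ (λ d e → c * d + c * (+ 2 * e)) (D-padded x (ℕP.n≤1+n n)) (xD-expansion n x) ⟩
  c * D n x + c * (+ 2 * (x * D n x))
    ≡⟨ collect c x (D n x) ⟩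
  c * ((+ 2 * x + + 1) * D n x) ∎
  where
  open ≡-Reasoning
  N = suc n
  c = + n + + n + + 1
  pred≤N : ℕ.pred n ℕ.≤ N
  pred≤N = ℕP.≤-trans ℕP.pred[n]≤n (ℕP.n≤1+n n)
  termwise : ∀ k → + suc n * (coeff (suc n) k * x ^ k) + + n * (coeff (ℕ.pred n) k * x ^ k)
                 ≡ c * (coeff n k * x ^ k) + c * (+ 2 * (coeffBelow n k * x ^ k))
  termwise k = begin
    + suc n * (coeff (suc n) k * x ^ k) + + n * (coeff (ℕ.pred n) k * x ^ k)
      ≡⟨ factor (+ suc n) (+ n) (coeff (suc n) k) (coeff (ℕ.pred n) k) (x ^ k) ⟩
    (+ suc n * coeff (suc n) k + + n * coeff (ℕ.pred n) k) * x ^ k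
      ≡⟨ cong (_* x ^ k) (coeff-recurrence n k) ⟩
    c * (coeff n k + + 2 * coeffBelow n k) * x ^ k
      ≡⟨ expand c (coeff n k) (coeffBelow n k) (x ^ k) ⟩
    c * (coeff n k * x ^ k) + c * (+ 2 * (coeffBelow n k * x ^ k)) ∎
    where
    factor : ∀ s n a b y → s * (a * y) + n * (b * y) ≡ (s * a + n * b) * y
    factor = solve-∀
    expand : ∀ c a b y → c * (a + + 2 * b) * y ≡ c * (a * y) + c * (+ 2 * (b * y))
    expand = solve-∀
  collect : ∀ c x d → c * d + c * (+ 2 * (x * d)) ≡ c * ((+ 2 * x + + 1) * d)
  collect = solve-∀

-- Chebyshev polynomials of the second kind in t, indexed so that U 0 = 0, U 1 = 1.
chebyshevU : ℤ → ℕ → ℤ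
chebyshevU t zero          = + 0
chebyshevU t (suc zero)    = + 1
chebyshevU t (suc (suc n)) = + 2 * t * chebyshevU t (suc n) - chebyshevU t n

convolution : ℤ → ℕ → ℤ
convolution x N = Σ≤ N (λ n → D n x * D (N ∸ n) x)

module _ (x : ℤ) where

  private
    t = + 2 * x + + 1

  weighted weightedLag : ℕ → ℤ
  weighted    N = Σ≤ N (λ n → + n * (D n x * D (N ∸ n) x))
  weightedLag N = Σ≤ N (λ n → + n * (D (ℕ.pred n) x * D (N ∸ n) x))

  -- Pairing the terms n and N−n:  2·weighted N = N·convolution N.
  weighted-symmetric : ∀ N → weighted N + weighted N ≡ + N * convolution x N
  weighted-symmetric N = begin
    weighted N + weighted N
      ≡⟨ cong (λ s → weighted N + s) (trans (Σ≤-reverse N _) (Σ≤-cong N reflected)) ⟩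
    weighted N + Σ≤ N (λ n → + (N ∸ n) * (D n x * D (N ∸ n) x))
      ≡⟨ Σ≤-+ N _ _ ⟨
    Σ≤ N (λ n → + n * (D n x * D (N ∸ n) x) + + (N ∸ n) * (D n x * D (N ∸ n) x))
      ≡⟨ Σ≤-cong N weights ⟩
    Σ≤ N (λ n → + N * (D n x * D (N ∸ n) x))
      ≡⟨ Σ≤-*ˡ N (+ N) _ ⟩
    + N * convolution x N ∎
    where
    open ≡-Reasoning
    reflected : ∀ n → n ℕ.≤ N → + (N ∸ n) * (D (N ∸ n) x * D (N ∸ (N ∸ n)) x) ≡ + (N ∸ n) * (D n x * D (N ∸ n) x)
    reflected n n≤N rewrite ℕP.m∸[m∸n]≡n n≤N = cong (+ (N ∸ n) *_) (ℤP.*-comm (D (N ∸ n) x) (D n x))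
    weights : ∀ n → n ℕ.≤ N → + n * (D n x * D (N ∸ n) x) + + (N ∸ n) * (D n x * D (N ∸ n) x) ≡ + N * (D n x * D (N ∸ n) x)
    weights n n≤N = trans (sym (ℤP.*-distribʳ-+ _ (+ n) (+ (N ∸ n))))
                          (cong (_* (D n x * D (N ∸ n) x)) (trans (sym (ℤP.pos-+ n (N ∸ n))) (cong +_ (ℕP.m+[n∸m]≡n n≤N))))

  -- The recurrence of D_n, multiplied by D_{M−n} and summed over n ≤ M.
  weighted-step : ∀ M → weighted (suc M) + weightedLag M ≡ t * (weighted M + weighted M + convolution x M)
  weighted-step M = begin
    weighted (suc M) + weightedLag M
      ≡⟨ cong (_+ weightedLag M) (trans (Σ≤-shift M _) (ℤP.+-identityˡ (Σ≤ M (λ n → + suc n * (D (suc n) x * E n))))) ⟩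
    Σ≤ M (λ n → + suc n * (D (suc n) x * E n)) + weightedLag M
      ≡⟨ Σ≤-+ M _ _ ⟨
    Σ≤ M (λ n → + suc n * (D (suc n) x * E n) + + n * (D (ℕ.pred n) x * E n))
      ≡⟨ Σ≤-cong M (λ n _ → termwise n) ⟩
    Σ≤ M (λ n → t * (+ n * (D n x * E n) + + n * (D n x * E n) + D n x * E n))
      ≡⟨ Σ≤-*ˡ M t _ ⟩
    t * Σ≤ M (λ n → + n * (D n x * E n) + + n * (D n x * E n) + D n x * E n)
      ≡⟨ cong (t *_) (trans (Σ≤-+ M _ _) (cong (_+ convolution x M) (Σ≤-+ M _ _))) ⟩
    t * (weighted M + weighted M + convolution x M) ∎
    where
    open ≡-Reasoning
    E : ℕ → ℤ
    E n = D (M ∸ n) x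
    termwise : ∀ n → + suc n * (D (suc n) x * E n) + + n * (D (ℕ.pred n) x * E n)
                   ≡ t * (+ n * (D n x * E n) + + n * (D n x * E n) + D n x * E n)
    termwise n = begin
      + suc n * (D (suc n) x * E n) + + n * (D (ℕ.pred n) x * E n)
        ≡⟨ factor (+ suc n) (+ n) (D (suc n) x) (D (ℕ.pred n) x) (E n) ⟩
      (+ suc n * D (suc n) x + + n * D (ℕ.pred n) x) * E n
        ≡⟨ cong (_* E n) (D-recurrence n x) ⟩
      (+ n + + n + + 1) * (t * D n x) * E n
        ≡⟨ expand (+ n) t (D n x) (E n) ⟩
      t * (+ n * (D n x * E n) + + n * (D n x * E n) + D n x * E n) ∎
      where
      factor : ∀ s n a b e → s * (a * e) + n * (b * e) ≡ (s * a + n * b) * e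
      factor = solve-∀
      expand : ∀ n t d e → (n + n + + 1) * (t * d) * e ≡ t * (n * (d * e) + n * (d * e) + d * e)
      expand = solve-∀

  weightedLag-shift : ∀ M → weightedLag (suc M) ≡ weighted M + convolution x M
  weightedLag-shift M = begin
    weightedLag (suc M)                                            ≡⟨ Σ≤-shift M _ ⟩
    + 0 * (D 0 x * D (suc M) x) + Σ≤ M (λ n → + suc n * (D n x * D (M ∸ n) x))
                                                                   ≡⟨ ℤP.+-identityˡ _ ⟩
    Σ≤ M (λ n → + suc n * (D n x * D (M ∸ n) x))                   ≡⟨ Σ≤-cong M (λ n _ → split n) ⟩
    Σ≤ M (λ n → + n * (D n x * D (M ∸ n) x) + D n x * D (M ∸ n) x) ≡⟨ Σ≤-+ M _ _ ⟩
    weighted M + convolution x M                                   ∎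
    where
    open ≡-Reasoning
    split : ∀ n → + suc n * (D n x * D (M ∸ n) x) ≡ + n * (D n x * D (M ∸ n) x) + D n x * D (M ∸ n) x
    split n = trans (cong (_* (D n x * D (M ∸ n) x)) (pos-suc n)) (distrib (+ n) _)
      where
      distrib : ∀ a q → (a + + 1) * q ≡ a * q + q
      distrib = solve-∀

  convolution-recurrence : ∀ N → convolution x (suc (suc N)) ≡ + 2 * t * convolution x (suc N) - convolution x N
  convolution-recurrence N = ℤP.*-cancelˡ-≡ (+ K) _ _ (begin
    + K * c₂
      ≡⟨ weighted-symmetric K ⟨
    weighted K + weighted K
      ≡⟨ cong (λ w → w + w) weighted-K ⟩
    (t * (W₁ + W₁ + c₁) - (W₀ + c₀)) + (t * (W₁ + W₁ + c₁) - (W₀ + c₀))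
      ≡⟨ regroup t W₁ c₁ W₀ c₀ ⟩
    + 2 * t * ((W₁ + W₁) + c₁) - ((W₀ + W₀) + + 2 * c₀)
      ≡⟨ cong₂ (λ a b → + 2 * t * (a + c₁) - (b + + 2 * c₀)) (weighted-symmetric (suc N)) (weighted-symmetric N) ⟩
    + 2 * t * (+ suc N * c₁ + c₁) - (+ N * c₀ + + 2 * c₀)
      ≡⟨ cong (λ s → + 2 * t * (s * c₁ + c₁) - (+ N * c₀ + + 2 * c₀)) (pos-suc N) ⟩
    + 2 * t * ((+ N + + 1) * c₁ + c₁) - (+ N * c₀ + + 2 * c₀)
      ≡⟨ factor t (+ N) c₁ c₀ ⟩
    (+ N + + 2) * (+ 2 * t * c₁ - c₀)
      ≡⟨ cong (_* (+ 2 * t * c₁ - c₀)) (ℤP.+-comm (+ N) (+ 2)) ⟩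
    + K * (+ 2 * t * c₁ - c₀) ∎)
    where
    open ≡-Reasoning
    K = suc (suc N)
    c₀ = convolution x N
    c₁ = convolution x (suc N)
    c₂ = convolution x K
    W₀ = weighted N
    W₁ = weighted (suc N)
    weighted-K : weighted K ≡ t * (W₁ + W₁ + c₁) - (W₀ + c₀)
    weighted-K = begin
      weighted K                                               ≡⟨ isolate (weighted K) (weightedLag (suc N)) ⟩
      (weighted K + weightedLag (suc N)) - weightedLag (suc N) ≡⟨ cong₂ _-_ (weighted-step (suc N)) (weightedLag-shift N) ⟩
      t * (W₁ + W₁ + c₁) - (W₀ + c₀)                           ∎
      where
      isolate : ∀ a b → a ≡ (a + b) - b
      isolate = solve-∀
    regroup : ∀ t W₁ c₁ W₀ c₀ → (t * (W₁ + W₁ + c₁) - (W₀ + c₀)) + (t * (W₁ + W₁ + c₁) - (W₀ + c₀))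
                               ≡ + 2 * t * ((W₁ + W₁) + c₁) - ((W₀ + W₀) + + 2 * c₀)
    regroup = solve-∀
    factor : ∀ t n c₁ c₀ → + 2 * t * ((n + + 1) * c₁ + c₁) - (n * c₀ + + 2 * c₀) ≡ (n + + 2) * (+ 2 * t * c₁ - c₀)
    factor = solve-∀

  D-one : D 1 x ≡ t
  D-one = identity x
    where
    identity : ∀ x → + 1 * + 1 + + 2 * (x * + 1) ≡ + 2 * x + + 1
    identity = solve-∀

  convolution≡chebyshev : ∀ N → convolution x N ≡ chebyshevU t (suc N)
  convolution≡chebyshev N = proj₁ (consecutive N)
    where
    consecutive : ∀ N → (convolution x N ≡ chebyshevU t (suc N)) × (convolution x (suc N) ≡ chebyshevU t (suc (suc N)))
    consecutive zero = refl , (begin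
      + 1 * D 1 x + D 1 x * + 1 ≡⟨ cong₂ _+_ (ℤP.*-identityˡ (D 1 x)) (ℤP.*-identityʳ (D 1 x)) ⟩
      D 1 x + D 1 x             ≡⟨ cong (λ d → d + d) D-one ⟩
      t + t                     ≡⟨ double t ⟩
      + 2 * t * + 1 - + 0       ∎)
      where
      open ≡-Reasoning
      double : ∀ t → t + t ≡ + 2 * t * + 1 - + 0
      double = solve-∀
    consecutive (suc N) with consecutive N
    ... | c₀≡U , c₁≡U = c₁≡U , trans (convolution-recurrence N) (cong₂ (λ a b → + 2 * t * a - b) c₁≡U c₀≡U)

-- The quadratic extension ℤ[√w]: a + b√w is the pair (a , b).  It is a commutative
-- semiring (indeed a ring) with propositional equality.
module QuadraticExtension (w : ℤ) where

  Quadratic : Set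
  Quadratic = ℤ × ℤ

  infixl 6 _⊕_
  infixl 7 _⊗_
  _⊕_ _⊗_ : Quadratic → Quadratic → Quadratic
  (a , b) ⊕ (c , d) = (a + c , b + d)
  (a , b) ⊗ (c , d) = (a * c + w * (b * d) , a * d + b * c)

  𝟘 𝟙 : Quadratic
  𝟘 = (+ 0 , + 0)
  𝟙 = (+ 1 , + 0)

  semiring : CommutativeSemiring 0ℓ 0ℓ
  semiring = record
    { Carrier = Quadratic
    ; _≈_ = _≡_
    ; _+_ = _⊕_
    ; _*_ = _⊗_
    ; 0# = 𝟘
    ; 1# = 𝟙
    ; isCommutativeSemiring = isCommutativeSemiringˡ (record
      { +-isCommutativeMonoid = record
        { isMonoid = record
          { isSemigroup = record
            { isMagma = record { isEquivalence = isEquivalence ; ∙-cong = cong₂ _⊕_ }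
            ; assoc   = λ { (a , b) (c , d) (e , f) → cong₂ _,_ (ℤP.+-assoc a c e) (ℤP.+-assoc b d f) } }
          ; identity = (λ { (a , b) → cong₂ _,_ (ℤP.+-identityˡ a) (ℤP.+-identityˡ b) })
                     , (λ { (a , b) → cong₂ _,_ (ℤP.+-identityʳ a) (ℤP.+-identityʳ b) }) }
        ; comm = λ { (a , b) (c , d) → cong₂ _,_ (ℤP.+-comm a c) (ℤP.+-comm b d) } }
      ; *-isCommutativeMonoid = record
        { isMonoid = record
          { isSemigroup = record
            { isMagma = record { isEquivalence = isEquivalence ; ∙-cong = cong₂ _⊗_ }
            ; assoc   = λ { (a , b) (c , d) (e , f) → cong₂ _,_ (assoc₁ a b c d e f w) (assoc₂ a b c d e f w) } }
          ; identity = (λ { (a , b) → cong₂ _,_ (identityˡ₁ a b w) (identityˡ₂ a b) })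
                     , (λ { (a , b) → cong₂ _,_ (identityʳ₁ a b w) (identityʳ₂ a b) }) }
        ; comm = λ { (a , b) (c , d) → cong₂ _,_ (comm₁ a b c d w) (comm₂ a b c d) } }
      ; distribʳ = λ { (a , b) (c , d) (e , f) → cong₂ _,_ (distrib₁ a b c d e f w) (distrib₂ a b c d e f) }
      ; zeroˡ    = λ { (a , b) → cong₂ _,_ (zero₁ a b w) (zero₂ a b) } }) }
    where
    assoc₁ : ∀ a b c d e f w → (a * c + w * (b * d)) * e + w * ((a * d + b * c) * f)
                             ≡ a * (c * e + w * (d * f)) + w * (b * (c * f + d * e))
    assoc₁ = solve-∀
    assoc₂ : ∀ a b c d e f w → (a * c + w * (b * d)) * f + (a * d + b * c) * e
                             ≡ a * (c * f + d * e) + b * (c * e + w * (d * f))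
    assoc₂ = solve-∀
    identityˡ₁ : ∀ a b w → + 1 * a + w * (+ 0 * b) ≡ a
    identityˡ₁ = solve-∀
    identityˡ₂ : ∀ a b → + 1 * b + + 0 * a ≡ b
    identityˡ₂ = solve-∀
    identityʳ₁ : ∀ a b w → a * + 1 + w * (b * + 0) ≡ a
    identityʳ₁ = solve-∀
    identityʳ₂ : ∀ a b → a * + 0 + b * + 1 ≡ b
    identityʳ₂ = solve-∀
    comm₁ : ∀ a b c d w → a * c + w * (b * d) ≡ c * a + w * (d * b)
    comm₁ = solve-∀
    comm₂ : ∀ a b c d → a * d + b * c ≡ c * b + d * a
    comm₂ = solve-∀
    distrib₁ : ∀ a b c d e f w → (c + e) * a + w * ((d + f) * b) ≡ (c * a + w * (d * b)) + (e * a + w * (f * b))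
    distrib₁ = solve-∀
    distrib₂ : ∀ a b c d e f → (c + e) * b + (d + f) * a ≡ (c * b + d * a) + (e * b + f * a)
    distrib₂ = solve-∀
    zero₁ : ∀ a b w → + 0 * a + w * (+ 0 * b) ≡ + 0
    zero₁ = solve-∀
    zero₂ : ∀ a b → + 0 * b + + 0 * a ≡ + 0
    zero₂ = solve-∀

  open import Algebra.Definitions.RawSemiring (CommutativeSemiring.rawSemiring semiring)
    public using () renaming (_^_ to _^ᵠ_; _×_ to _×ᵠ_)

  ×ᵠ-components : ∀ n a b → n ×ᵠ (a , b) ≡ (+ n * a , + n * b)
  ×ᵠ-components zero    a b = refl
  ×ᵠ-components (suc n) a b rewrite ×ᵠ-components n a b =
    cong₂ _,_ (sym (step n a)) (sym (step n b))
    where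
    step : ∀ n a → + suc n * a ≡ a + + n * a
    step n a = trans (cong (_* a) (pos-suc n)) (distrib (+ n) a)
      where
      distrib : ∀ n a → (n + + 1) * a ≡ a + n * a
      distrib = solve-∀

  rational-power : ∀ t n → (t , + 0) ^ᵠ n ≡ (t ^ n , + 0)
  rational-power t zero    = refl
  rational-power t (suc n) rewrite rational-power t n = cong₂ _,_ (real t (t ^ n) w) (imaginary t (t ^ n))
    where
    real : ∀ t a w → t * a + w * (+ 0 * + 0) ≡ t * a
    real = solve-∀
    imaginary : ∀ t a → t * + 0 + + 0 * a ≡ + 0
    imaginary = solve-∀

  root-power-odd : ∀ m → (+ 0 , + 1) ^ᵠ suc (m ℕ.+ m) ≡ (+ 0 , w ^ m)
  root-power-odd zero    = cong₂ _,_ (real w) (imaginary w)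
    where
    real : ∀ w → + 0 * + 1 + w * (+ 1 * + 0) ≡ + 0
    real = solve-∀
    imaginary : ∀ w → + 0 * + 0 + + 1 * + 1 ≡ + 1
    imaginary = solve-∀
  root-power-odd (suc m) = begin
    ρ ^ᵠ suc (suc m ℕ.+ suc m)     ≡⟨ cong (λ n → ρ ^ᵠ suc (suc n)) (ℕP.+-suc m m) ⟩
    ρ ⊗ (ρ ⊗ (ρ ^ᵠ suc (m ℕ.+ m))) ≡⟨ cong (λ z → ρ ⊗ (ρ ⊗ z)) (root-power-odd m) ⟩
    ρ ⊗ (ρ ⊗ (+ 0 , w ^ m))        ≡⟨ cong₂ _,_ (real (w ^ m) w) (imaginary (w ^ m) w) ⟩
    (+ 0 , w * w ^ m)              ∎
    where
    open ≡-Reasoning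
    ρ = (+ 0 , + 1)
    real : ∀ a w → + 0 * (+ 0 * + 0 + w * (+ 1 * a)) + w * (+ 1 * (+ 0 * a + + 1 * + 0)) ≡ + 0
    real = solve-∀
    imaginary : ∀ a w → + 0 * (+ 0 * a + + 1 * + 0) + + 1 * (+ 0 * + 0 + w * (+ 1 * a)) ≡ w * a
    imaginary = solve-∀

-- With w = t² − 1, the element α = t + √w satisfies α² = 2tα − 1, so the
-- √w-components of its powers follow the Chebyshev recurrence:
-- αⁿ = (… , U_n(t)).
module _ (t : ℤ) where
  open QuadraticExtension (t * t - + 1)

  α : Quadratic
  α = (t , + 1)

  chebyshev-power : ∀ n → proj₂ (α ^ᵠ n) ≡ chebyshevU t n
  chebyshev-power n = proj₁ (consecutive n)
    where
    recurrence : ∀ n → proj₂ (α ^ᵠ suc (suc n)) ≡ + 2 * t * proj₂ (α ^ᵠ suc n) - proj₂ (α ^ᵠ n)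
    recurrence n = identity t (proj₁ (α ^ᵠ n)) (proj₂ (α ^ᵠ n))
      where
      identity : ∀ t a b → t * (t * b + + 1 * a) + + 1 * (t * a + (t * t - + 1) * (+ 1 * b))
                         ≡ + 2 * t * (t * b + + 1 * a) - b
      identity = solve-∀
    consecutive : ∀ n → (proj₂ (α ^ᵠ n) ≡ chebyshevU t n) × (proj₂ (α ^ᵠ suc n) ≡ chebyshevU t (suc n))
    consecutive zero    = refl , one t
      where
      one : ∀ t → t * + 0 + + 1 * + 1 ≡ + 1
      one = solve-∀
    consecutive (suc n) with consecutive n
    ... | Uₙ , Uₙ₊₁ = Uₙ₊₁ , trans (recurrence n) (cong₂ (λ a b → + 2 * t * a - b) Uₙ₊₁ Uₙ)

^-distrib-* : ∀ a b n → (a * b) ^ n ≡ a ^ n * b ^ n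
^-distrib-* a b zero    = refl
^-distrib-* a b (suc n) rewrite ^-distrib-* a b n = regroup a b (a ^ n) (b ^ n)
  where
  regroup : ∀ a b c d → a * b * (c * d) ≡ a * c * (b * d)
  regroup = solve-∀

neg-^-odd : ∀ a m → (- a) ^ suc (m ℕ.+ m) ≡ - a ^ suc (m ℕ.+ m)
neg-^-odd a zero    = identity a
  where
  identity : ∀ a → (- a) * + 1 ≡ - (a * + 1)
  identity = solve-∀
neg-^-odd a (suc m) = begin
  (- a) ^ suc (suc m ℕ.+ suc m)           ≡⟨ cong (λ n → (- a) ^ suc (suc n)) (ℕP.+-suc m m) ⟩
  (- a) * ((- a) * (- a) ^ suc (m ℕ.+ m)) ≡⟨ cong (λ z → (- a) * ((- a) * z)) (neg-^-odd a m) ⟩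
  (- a) * ((- a) * - a ^ suc (m ℕ.+ m))   ≡⟨ identity a (a ^ suc (m ℕ.+ m)) ⟩
  - (a * (a * a ^ suc (m ℕ.+ m)))         ≡⟨ cong (λ n → - a ^ suc (suc n)) (ℕP.+-suc m m) ⟨
  - a ^ suc (suc m ℕ.+ suc m)             ∎
  where
  open ≡-Reasoning
  identity : ∀ a b → (- a) * ((- a) * - b) ≡ - (a * (a * b))
  identity = solve-∀

module _ where
  open import Algebra.Definitions.RawSemiring (CommutativeSemiring.rawSemiring ℤP.+-*-commutativeSemiring)
    using () renaming (_^_ to _^ₛ_; _×_ to _×ₛ_)

  ^ₛ≡^ : ∀ a n → a ^ₛ n ≡ a ^ n
  ^ₛ≡^ a zero    = refl
  ^ₛ≡^ a (suc n) = cong (a *_) (^ₛ≡^ a n)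

  ×ₛ≡* : ∀ n a → n ×ₛ a ≡ + n * a
  ×ₛ≡* zero    a = refl
  ×ₛ≡* (suc n) a = trans (cong (λ m → a + m) (×ₛ≡* n a)) (sym (trans (cong (_* a) (pos-suc n)) (distrib (+ n) a)))
    where
    distrib : ∀ n a → (n + + 1) * a ≡ a + n * a
    distrib = solve-∀

-- A monic polynomial X^d + c_{d−1}X^{d−1} + … + c₀, represented by the
-- list [c₀, …, c_{d−1}] of its lower coefficients (so d is the length).
evalMonic : List ℤ → ℤ → ℤ
evalMonic []       z = + 1
evalMonic (c ∷ cs) z = c + z * evalMonic cs z

-- The quotient of a monic polynomial of positive degree by X − r,
-- computed by synthetic division.
divideMonic : ℤ → List ℤ → List ℤ
divideMonic r []                = []
divideMonic r (c ∷ [])          = []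
divideMonic r (c ∷ cs@(_ ∷ _))  = evalMonic cs r ∷ divideMonic r cs

divideMonic-length : ∀ r c cs → length (divideMonic r (c ∷ cs)) ≡ length cs
divideMonic-length r c []       = refl
divideMonic-length r c (d ∷ ds) = cong suc (divideMonic-length r d ds)

divideMonic-spec : ∀ r c cs z → evalMonic (c ∷ cs) z
                              ≡ evalMonic (c ∷ cs) r + (z - r) * evalMonic (divideMonic r (c ∷ cs)) z
divideMonic-spec r c []            z = identity r z c
  where
  identity : ∀ r z c → c + z * + 1 ≡ c + r * + 1 + (z - r) * + 1
  identity = solve-∀
divideMonic-spec r c cs@(d ∷ ds) z =
  trans (cong (λ e → c + z * e) (divideMonic-spec r d ds z)) (identity r z c (evalMonic cs r) (evalMonic (divideMonic r cs) z))
  where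
  identity : ∀ r z c g q → c + z * (g + (z - r) * q) ≡ c + r * g + (z - r) * (g + z * q)
  identity = solve-∀

xPowerMinusOne : ℕ → List ℤ
xPowerMinusOne m = - + 1 ∷ replicate m (+ 0)

xPowerMinusOne-eval : ∀ m z → evalMonic (xPowerMinusOne m) z ≡ z ^ suc m - + 1
xPowerMinusOne-eval m z = trans (cong (λ e → - + 1 + z * e) (monomial m)) (ℤP.+-comm (- + 1) (z * z ^ m))
  where
  monomial : ∀ m → evalMonic (replicate m (+ 0)) z ≡ z ^ m
  monomial zero    = refl
  monomial (suc m) = trans (ℤP.+-identityˡ _) (cong (z *_) (monomial m))

squares : ℕ → List ℤ
squares zero    = []
squares (suc i) = + (suc i ℕ.* suc i) ∷ squares i

squares-length : ∀ i → length (squares i) ≡ i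
squares-length zero    = refl
squares-length (suc i) = cong suc (squares-length i)

all-squares : ∀ {P : ℤ → Set} i → (∀ {y} → 0 ℕ.< y → y ℕ.≤ i → P (+ (y ℕ.* y))) → All P (squares i)
all-squares zero    _     = []
all-squares (suc i) holds = holds (s≤s z≤n) ℕP.≤-refl ∷ all-squares i (λ 0<y y≤i → holds 0<y (ℕP.m≤n⇒m≤1+n y≤i))

pos-difference : ∀ {m n} → m ℕ.≤ n → + n - + m ≡ + (n ∸ m)
pos-difference {m} {n} m≤n = trans (ℤP.m-n≡m⊖n n m) (ℤP.⊖-≥ m≤n)

module Congruence (p : ℕ) where

  infix 4 _≈_
  record _≈_ (a b : ℤ) : Set where
    constructor mod
    field difference : + p Signed.∣ (a - b)
  open _≈_ public

  ≈-reflexive : ∀ {a b} → a ≡ b → a ≈ b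
  ≈-reflexive {a} refl = mod (Signed.divides (+ 0) (trans (ℤP.+-inverseʳ a) (sym (ℤP.*-zeroˡ (+ p)))))

  ≈-refl : ∀ {a} → a ≈ a
  ≈-refl = ≈-reflexive refl

  ≈-sym : ∀ {a b} → a ≈ b → b ≈ a
  ≈-sym {a} {b} (mod d) = mod (subst (+ p Signed.∣_) (flip a b) (Signed.∣m⇒∣-m d))
    where
    flip : ∀ a b → - (a - b) ≡ b - a
    flip = solve-∀

  ≈-trans : ∀ {a b c} → a ≈ b → b ≈ c → a ≈ c
  ≈-trans {a} {b} {c} (mod d) (mod e) = mod (subst (+ p Signed.∣_) (chain a b c) (Signed.∣m∣n⇒∣m+n d e))
    where
    chain : ∀ a b c → (a - b) + (b - c) ≡ a - c
    chain = solve-∀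

  ≈-setoid : Setoid 0ℓ 0ℓ
  ≈-setoid = record { _≈_ = _≈_ ; isEquivalence = record { refl = ≈-refl ; sym = ≈-sym ; trans = ≈-trans } }

  +-cong : ∀ {a b c d} → a ≈ b → c ≈ d → a + c ≈ b + d
  +-cong {a} {b} {c} {d} (mod e) (mod f) = mod (subst (+ p Signed.∣_) (regroup a b c d) (Signed.∣m∣n⇒∣m+n e f))
    where
    regroup : ∀ a b c d → (a - b) + (c - d) ≡ (a + c) - (b + d)
    regroup = solve-∀

  neg-cong : ∀ {a b} → a ≈ b → - a ≈ - b
  neg-cong {a} {b} (mod e) = mod (subst (+ p Signed.∣_) (regroup a b) (Signed.∣m⇒∣-m e))
    where
    regroup : ∀ a b → - (a - b) ≡ - a - - b
    regroup = solve-∀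

  -‿cong : ∀ {a b c d} → a ≈ b → c ≈ d → a - c ≈ b - d
  -‿cong a≈b c≈d = +-cong a≈b (neg-cong c≈d)

  *-cong : ∀ {a b c d} → a ≈ b → c ≈ d → a * c ≈ b * d
  *-cong {a} {b} {c} {d} (mod e) (mod f) =
    mod (subst (+ p Signed.∣_) (regroup a b c d) (Signed.∣m∣n⇒∣m+n (Signed.∣n⇒∣m*n a f) (Signed.∣n⇒∣m*n d e)))
    where
    regroup : ∀ a b c d → a * (c - d) + d * (a - b) ≡ a * c - b * d
    regroup = solve-∀

  ^-cong : ∀ {a b} n → a ≈ b → a ^ n ≈ b ^ n
  ^-cong zero    a≈b = ≈-refl
  ^-cong (suc n) a≈b = *-cong a≈b (^-cong n a≈b)

  Σ≤-cong≈ : ∀ N {f g : ℕ → ℤ} → (∀ k → k ℕ.≤ N → f k ≈ g k) → Σ≤ N f ≈ Σ≤ N g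
  Σ≤-cong≈ zero    f≈g = f≈g 0 z≤n
  Σ≤-cong≈ (suc N) f≈g = +-cong (Σ≤-cong≈ N (λ k k≤N → f≈g k (ℕP.m≤n⇒m≤1+n k≤N))) (f≈g (suc N) ℕP.≤-refl)

  multiple≈0 : ∀ r → + p * r ≈ + 0
  multiple≈0 r = mod (Signed.divides r (trans (ℤP.+-identityʳ (+ p * r)) (ℤP.*-comm (+ p) r)))

  +-multiple : ∀ a r → a + + p * r ≈ a
  +-multiple a r = ≈-trans (+-cong (≈-refl {a}) (multiple≈0 r)) (≈-reflexive (ℤP.+-identityʳ a))

  ≈0⇒∣ : ∀ {n} → + n ≈ + 0 → p ∣ₙ n
  ≈0⇒∣ {n} (mod d) = subst (p ∣ₙ_) (ℕP.+-identityʳ n) (Signed.∣⇒∣ᵤ d)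

  ≈⇒-≈0 : ∀ {a b} → a ≈ b → a - b ≈ + 0
  ≈⇒-≈0 {a} {b} a≈b = ≈-trans (-‿cong a≈b (≈-refl {b})) (≈-reflexive (ℤP.+-inverseʳ b))

  -≈0⇒≈ : ∀ {a b} → a - b ≈ + 0 → a ≈ b
  -≈0⇒≈ {a} {b} a-b≈0 =
    ≈-trans (≈-reflexive (regroup a b)) (≈-trans (+-cong a-b≈0 (≈-refl {b})) (≈-reflexive (ℤP.+-identityˡ b)))
    where
    regroup : ∀ a b → a ≡ (a - b) + b
    regroup = solve-∀

odd-prime-half>0 : ∀ h → Prime (suc (h ℕ.+ h)) → 0 ℕ.< h
odd-prime-half>0 zero    isPrime = contradiction isPrime ¬prime[1]
odd-prime-half>0 (suc h) _       = s≤s z≤n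

module OddPrime (h : ℕ) (isPrime : Prime (suc (h ℕ.+ h))) where

  p : ℕ
  p = suc (h ℕ.+ h)

  open Congruence p public
  module ≈-Reasoning = Relation.Binary.Reasoning.Setoid ≈-setoid

  h>0 : 0 ℕ.< h
  h>0 = odd-prime-half>0 h isPrime

  two<p : 2 ℕ.< p
  two<p = s≤s (ℕP.+-mono-≤ h>0 h>0)

  ≤h⇒<p : ∀ {y} → y ℕ.≤ h → y ℕ.< p
  ≤h⇒<p y≤h = s≤s (ℕP.≤-trans y≤h (ℕP.m≤m+n h h))

  euclid : ∀ a b → a * b ≈ + 0 → a ≈ + 0 ⊎ b ≈ + 0
  euclid a b (mod d) with euclidsLemma ∣ a ∣ ∣ b ∣ isPrime (subst (p ∣ₙ_) (ℤP.abs-* a b) (Signed.∣⇒∣ᵤ (onlyZero {a * b} d)))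
    where
    onlyZero : ∀ {c} → + p Signed.∣ (c - + 0) → + p Signed.∣ c
    onlyZero {c} = subst (+ p Signed.∣_) (ℤP.+-identityʳ c)
  ... | inj₁ p∣a = inj₁ (mod (Signed.∣ᵤ⇒∣ (subst (λ c → p ∣ₙ ∣ c ∣) (sym (ℤP.+-identityʳ a)) p∣a)))
  ... | inj₂ p∣b = inj₂ (mod (Signed.∣ᵤ⇒∣ (subst (λ c → p ∣ₙ ∣ c ∣) (sym (ℤP.+-identityʳ b)) p∣b)))

  cancel : ∀ {c a b} → ¬ c ≈ + 0 → c * a ≈ c * b → a ≈ b
  cancel {c} {a} {b} c≉0 ca≈cb = [ (λ c≈0 → contradiction c≈0 c≉0) , -≈0⇒≈ ]′ (euclid c (a - b) c[a-b]≈0)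
    where
    factor : ∀ c a b → c * (a - b) ≡ c * a - c * b
    factor = solve-∀
    c[a-b]≈0 : c * (a - b) ≈ + 0
    c[a-b]≈0 = ≈-trans (≈-reflexive (factor c a b)) (≈⇒-≈0 ca≈cb)

  nonzero : ∀ {n} → 0 ℕ.< n → n ℕ.< p → ¬ + n ≈ + 0
  nonzero {n@(suc _)} _ n<p n≈0 = >⇒∤ n<p (≈0⇒∣ n≈0)

  one≉0 : ¬ + 1 ≈ + 0
  one≉0 = nonzero (s≤s z≤n) (ℕP.<-trans (s≤s (s≤s z≤n)) two<p)

  frobenius-ℤ : ∀ a b → (a + b) ^ p ≈ a ^ p + b ^ p
  frobenius-ℤ a b with Frobenius.frobenius ℤP.+-*-commutativeSemiring isPrime a b
  ... | r , expansion = ≈-trans (≈-reflexive expansionℤ) (+-multiple (a ^ p + b ^ p) r)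
    where
    expansionℤ : (a + b) ^ p ≡ a ^ p + b ^ p + + p * r
    expansionℤ = trans (sym (^ₛ≡^ (a + b) p))
      (trans expansion (cong₂ _+_ (cong₂ _+_ (^ₛ≡^ a p) (^ₛ≡^ b p)) (×ₛ≡* p r)))

  -- Fermat's little theorem, first for natural numbers by induction using
  -- Frobenius, then for negative integers since p is odd.
  fermat : ∀ a → a ^ p ≈ a
  fermat (+ n)      = fermat-ℕ n
    where
    fermat-ℕ : ∀ n → (+ n) ^ p ≈ + n
    fermat-ℕ zero    = ≈-refl
    fermat-ℕ (suc n) = begin
      (+ suc n) ^ p         ≡⟨ cong (_^ p) (pos-suc n) ⟩
      (+ n + + 1) ^ p       ≈⟨ frobenius-ℤ (+ n) (+ 1) ⟩
      (+ n) ^ p + (+ 1) ^ p ≈⟨ +-cong (fermat-ℕ n) (≈-reflexive (ℤP.^-zeroˡ p)) ⟩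
      + n + + 1             ≡⟨ pos-suc n ⟨
      + suc n               ∎
      where open ≈-Reasoning
  fermat -[1+ n ] = ≈-trans (≈-reflexive (neg-^-odd (+ suc n) h)) (neg-cong (fermat (+ suc n)))

  fermat-unit : ∀ a → ¬ a ≈ + 0 → a ^ (h ℕ.+ h) ≈ + 1
  fermat-unit a a≉0 = cancel a≉0 (begin
    a * a ^ (h ℕ.+ h) ≈⟨ fermat a ⟩
    a                 ≡⟨ ℤP.*-identityʳ a ⟨
    a * + 1           ∎)
    where open ≈-Reasoning

  -- U_p(t) ≡ (t² − 1)^((p−1)/2): Frobenius in ℤ[√(t²−1)] applied to
  -- α = t + √(t²−1), whose √-component of αᵖ is U_p(t).
  chebyshev-at-p : ∀ t → chebyshevU t p ≈ (t * t - + 1) ^ h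
  chebyshev-at-p t with Frobenius.frobenius (QuadraticExtension.semiring (t * t - + 1)) isPrime (t , + 0) (+ 0 , + 1)
  ... | r , expansion =
    ≈-trans (≈-reflexive components) (≈-trans (+-multiple _ (proj₂ r)) (≈-reflexive (ℤP.+-identityˡ _)))
    where
    w = t * t - + 1
    open QuadraticExtension w
    components : chebyshevU t p ≡ (+ 0 + w ^ h) + + p * proj₂ r
    components = begin
      chebyshevU t p
        ≡⟨ chebyshev-power t p ⟨
      proj₂ (α t ^ᵠ p)
        ≡⟨ cong (λ a → proj₂ (a ^ᵠ p)) (cong₂ _,_ (sym (ℤP.+-identityʳ t)) refl) ⟩
      proj₂ (((t , + 0) ⊕ (+ 0 , + 1)) ^ᵠ p)
        ≡⟨ cong proj₂ expansion ⟩
      proj₂ ((t , + 0) ^ᵠ p ⊕ (+ 0 , + 1) ^ᵠ p ⊕ p ×ᵠ r)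
        ≡⟨ cong₂ (λ u v → proj₂ (u ⊕ v ⊕ p ×ᵠ r)) (rational-power t p) (root-power-odd h) ⟩
      proj₂ ((t ^ p , + 0) ⊕ (+ 0 , w ^ h) ⊕ p ×ᵠ r)
        ≡⟨ cong (λ u → proj₂ ((t ^ p , + 0) ⊕ (+ 0 , w ^ h) ⊕ u)) (×ᵠ-components p (proj₁ r) (proj₂ r)) ⟩
      (+ 0 + w ^ h) + + p * proj₂ r ∎
      where open ≡-Reasoning

  factorial²≉0 : ∀ {k} → k ℕ.< p → ¬ factorial² k ≈ + 0
  factorial²≉0 {zero}  _   = one≉0
  factorial²≉0 {suc k} k<p F≈0 =
    [ k²≉0 , factorial²≉0 (ℕP.<-trans (ℕP.n<1+n k) k<p) ]′
      (euclid (+ suc k * + suc k) (factorial² k) (≈-trans (≈-reflexive (sym (factorial²-suc k))) F≈0))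
    where
    k≉0 : ¬ + suc k ≈ + 0
    k≉0 = nonzero (s≤s z≤n) k<p
    k²≉0 : ¬ + suc k * + suc k ≈ + 0
    k²≉0 k²≈0 = [ k≉0 , k≉0 ]′ (euclid (+ suc k) (+ suc k) k²≈0)

  pairProduct-cong : ∀ k {y z} → y ≈ z → pairProduct k y ≈ pairProduct k z
  pairProduct-cong zero    y≈z = ≈-refl
  pairProduct-cong (suc k) {y} {z} y≈z =
    *-cong (pairProduct-cong k y≈z) (*-cong (+-cong (+-cong y≈z (≈-refl {+ k})) (≈-refl {+ 1})) (-‿cong y≈z (≈-refl {+ k})))

  reflection-index : ∀ {n} → n ℕ.≤ h ℕ.+ h → - + n - + 1 ≈ + (h ℕ.+ h ∸ n)
  reflection-index {n} n≤N = ≈-sym (≈-trans (≈-reflexive shift) (+-multiple (- + n - + 1) (+ 1)))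
    where
    open ≡-Reasoning
    N = h ℕ.+ h
    split : + N ≡ + (N ∸ n) + + n
    split = trans (cong +_ (sym (ℕP.m∸n+n≡m n≤N))) (ℤP.pos-+ (N ∸ n) n)
    identity : ∀ m n → m ≡ - n - + 1 + (m + n + + 1) * + 1
    identity = solve-∀
    shift : + (N ∸ n) ≡ - + n - + 1 + + p * + 1
    shift = begin
      + (N ∸ n)                                   ≡⟨ identity (+ (N ∸ n)) (+ n) ⟩
      - + n - + 1 + (+ (N ∸ n) + + n + + 1) * + 1 ≡⟨ cong (λ m → - + n - + 1 + (m + + 1) * + 1) split ⟨
      - + n - + 1 + (+ N + + 1) * + 1             ≡⟨ cong (λ m → - + n - + 1 + m * + 1) (pos-suc N) ⟨
      - + n - + 1 + + p * + 1                     ∎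

  -- Modulo p the indices n and p − 1 − n give the same coefficients,
  -- by the reflection symmetry of P_k.
  coeff-reflect : ∀ {n k} → n ℕ.≤ h ℕ.+ h → k ℕ.≤ h ℕ.+ h → coeff n k ≈ coeff (h ℕ.+ h ∸ n) k
  coeff-reflect {n} {k} n≤N k≤N = cancel (factorial²≉0 (s≤s k≤N)) (begin
    factorial² k * coeff n k             ≡⟨ coeff-product n k ⟩
    pairProduct k (+ n)                  ≡⟨ pairProduct-reflect k (+ n) ⟨
    pairProduct k (- + n - + 1)          ≈⟨ pairProduct-cong k (reflection-index n≤N) ⟩
    pairProduct k (+ (h ℕ.+ h ∸ n))      ≡⟨ coeff-product (h ℕ.+ h ∸ n) k ⟨
    factorial² k * coeff (h ℕ.+ h ∸ n) k ∎)
    where open ≈-Reasoning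

  D-reflect : ∀ {n} x → n ℕ.≤ h ℕ.+ h → D n x ≈ D (h ℕ.+ h ∸ n) x
  D-reflect {n} x n≤N = begin
    D n x                                ≡⟨ D-padded x n≤N ⟨
    Σ≤ N (λ k → coeff n k * x ^ k)       ≈⟨ Σ≤-cong≈ N (λ k k≤N → *-cong (coeff-reflect n≤N k≤N) (≈-refl {x ^ k})) ⟩
    Σ≤ N (λ k → coeff (N ∸ n) k * x ^ k) ≡⟨ D-padded x (ℕP.m∸n≤m N n) ⟩
    D (N ∸ n) x                          ∎
    where
    open ≈-Reasoning
    N = h ℕ.+ h

  sum-of-squares : ∀ x → Σ≤ (h ℕ.+ h) (λ k → D k x * D k x) ≈ (x * (x + + 1)) ^ h
  sum-of-squares x = begin
    Σ≤ N (λ k → D k x * D k x) ≈⟨ Σ≤-cong≈ N (λ k k≤N → *-cong (≈-refl {D k x}) (D-reflect x k≤N)) ⟩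
    convolution x N            ≡⟨ convolution≡chebyshev x N ⟩
    chebyshevU t p             ≈⟨ chebyshev-at-p t ⟩
    (t * t - + 1) ^ h          ≡⟨ cong (_^ h) (quadruple x) ⟩
    (+ 2 * + 2 * u) ^ h        ≡⟨ ^-distrib-* (+ 2 * + 2) u h ⟩
    (+ 2 * + 2) ^ h * u ^ h    ≡⟨ cong (_* u ^ h) (trans (^-distrib-* (+ 2) (+ 2) h) (sym (ℤP.^-distribˡ-+-* (+ 2) h h))) ⟩
    (+ 2) ^ (h ℕ.+ h) * u ^ h  ≈⟨ *-cong (fermat-unit (+ 2) (nonzero (s≤s z≤n) two<p)) (≈-refl {u ^ h}) ⟩
    + 1 * u ^ h                ≡⟨ ℤP.*-identityˡ (u ^ h) ⟩
    u ^ h                      ∎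
    where
    open ≈-Reasoning
    N = h ℕ.+ h
    t = + 2 * x + + 1
    u = x * (x + + 1)
    quadruple : ∀ x → (+ 2 * x + + 1) * (+ 2 * x + + 1) - + 1 ≡ + 2 * + 2 * (x * (x + + 1))
    quadruple = solve-∀

  lagrange : ∀ cs rs → AllPairs (λ a b → ¬ a ≈ b) rs → All (λ r → evalMonic cs r ≈ + 0) rs
           → length rs ℕ.≤ length cs
  lagrange cs       []       _                 _             = z≤n
  lagrange []       (r ∷ rs) _                 (1≈0 ∷ _)     = contradiction 1≈0 one≉0
  lagrange (c ∷ cs) (r ∷ rs) (r≉rs ∷ distinct) (fr≈0 ∷ fs≈0) =
    s≤s (subst (length rs ℕ.≤_) (divideMonic-length r c cs)
               (lagrange (divideMonic r (c ∷ cs)) rs distinct (All.zipWith quotient-root (r≉rs , fs≈0))))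
    where
    f = c ∷ cs
    quotient-root : ∀ {s} → ¬ r ≈ s × evalMonic f s ≈ + 0 → evalMonic (divideMonic r f) s ≈ + 0
    quotient-root {s} (r≉s , fs≈0) =
      [ (λ s-r≈0 → contradiction (≈-sym (-≈0⇒≈ s-r≈0)) r≉s) , (λ q≈0 → q≈0) ]′ (euclid (s - r) _ product≈0)
      where
      isolate : ∀ a b → b ≡ (a + b) - a
      isolate = solve-∀
      product≈0 : (s - r) * evalMonic (divideMonic r f) s ≈ + 0
      product≈0 = ≈-trans (≈-reflexive (trans (isolate (evalMonic f r) _) (cong (_- evalMonic f r) (sym (divideMonic-spec r c cs s)))))
                          (-‿cong fs≈0 fr≈0)

  -- 0 < y < x ≤ h ⇒ x² ≢ y², as x² − y² = (x − y)(x + y) with both factors in (0, p).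
  squares-incongruent : ∀ {x y} → 0 ℕ.< y → y ℕ.< x → x ℕ.≤ h → ¬ + (x ℕ.* x) ≈ + (y ℕ.* y)
  squares-incongruent {x} {y} 0<y y<x x≤h x²≈y² =
    [ nonzero (ℕP.m<n⇒0<n∸m y<x) (ℕP.≤-<-trans (ℕP.m∸n≤m x y) (≤h⇒<p x≤h))
    , nonzero (ℕP.<-≤-trans 0<y (ℕP.m≤n+m y x)) (s≤s (ℕP.+-mono-≤ x≤h (ℕP.≤-trans (ℕP.<⇒≤ y<x) x≤h))) ]′
      (euclid (+ (x ∸ y)) (+ (x ℕ.+ y)) factored)
    where
    identity : ∀ x y → x * x - y * y ≡ (x - y) * (x + y)
    identity = solve-∀
    factored : + (x ∸ y) * + (x ℕ.+ y) ≈ + 0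
    factored = ≈-trans (≈-reflexive (begin
      + (x ∸ y) * + (x ℕ.+ y)   ≡⟨ cong₂ _*_ (pos-difference (ℕP.<⇒≤ y<x)) (sym (ℤP.pos-+ x y)) ⟨
      (+ x - + y) * (+ x + + y) ≡⟨ identity (+ x) (+ y) ⟨
      + x * + x - + y * + y     ≡⟨ cong₂ _-_ (ℤP.pos-* x x) (ℤP.pos-* y y) ⟨
      + (x ℕ.* x) - + (y ℕ.* y)            ∎)) (≈⇒-≈0 x²≈y²)
      where open ≡-Reasoning

  squares-distinct : ∀ {i} → i ℕ.≤ h → AllPairs (λ a b → ¬ a ≈ b) (squares i)
  squares-distinct {zero}  _   = []
  squares-distinct {suc i} i<h =
    all-squares i (λ 0<y y≤i → squares-incongruent 0<y (s≤s y≤i) i<h) ∷ squares-distinct (ℕP.<⇒≤ i<h)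

  square-power : ∀ y → ¬ + y ≈ + 0 → (+ (y ℕ.* y)) ^ h ≈ + 1
  square-power y y≉0 = ≈-trans (≈-reflexive (begin
    (+ (y ℕ.* y)) ^ h     ≡⟨ cong (_^ h) (ℤP.pos-* y y) ⟩
    (+ y * + y) ^ h       ≡⟨ ^-distrib-* (+ y) (+ y) h ⟩
    (+ y) ^ h * (+ y) ^ h ≡⟨ ℤP.^-distribˡ-+-* (+ y) h h ⟨
    (+ y) ^ (h ℕ.+ h)       ∎)) (fermat-unit (+ y) y≉0)
    where open ≡-Reasoning

  unitPolynomial : List ℤ
  unitPolynomial = xPowerMinusOne (ℕ.pred h)

  h≡suc[pred[h]] : suc (ℕ.pred h) ≡ h
  h≡suc[pred[h]] = ℕP.suc-pred h {{ℕ.>-nonZero h>0}}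

  unitPolynomial-length : length unitPolynomial ≡ h
  unitPolynomial-length = trans (cong suc (length-replicate (ℕ.pred h))) h≡suc[pred[h]]

  unitPolynomial-root : ∀ {a} → a ^ h ≈ + 1 → evalMonic unitPolynomial a ≈ + 0
  unitPolynomial-root {a} aʰ≈1 =
    ≈-trans (≈-reflexive (trans (xPowerMinusOne-eval (ℕ.pred h) a) (cong (λ n → a ^ n - + 1) h≡suc[pred[h]])))
            (≈⇒-≈0 aʰ≈1)

  -- The h squares 1², …, h² are distinct roots of X^h − 1 …
  squares-roots : All (λ r → evalMonic unitPolynomial r ≈ + 0) (squares h)
  squares-roots = all-squares h (λ {y} 0<y y≤h → unitPolynomial-root (square-power y (nonzero 0<y (≤h⇒<p y≤h))))

  -- … so by Lagrange no other residue class satisfies a^h ≡ 1.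
  power≈1⇒square : ∀ {a} → a ^ h ≈ + 1 → (∀ {y} → 0 ℕ.< y → y ℕ.≤ h → ¬ a ≈ + (y ℕ.* y)) → ⊥
  power≈1⇒square {a} aʰ≈1 nonsquare = ℕP.<⇒≱ (ℕP.n<1+n h) (begin
    suc h                  ≡⟨ cong suc (squares-length h) ⟨
    length (a ∷ squares h) ≤⟨ lagrange unitPolynomial (a ∷ squares h) distinct (unitPolynomial-root aʰ≈1 ∷ squares-roots) ⟩
    length unitPolynomial  ≡⟨ unitPolynomial-length ⟩
    h                      ∎)
    where
    open ℕP.≤-Reasoning
    distinct : AllPairs (λ a b → ¬ a ≈ b) (a ∷ squares h)
    distinct = all-squares h nonsquare ∷ squares-distinct ℕP.≤-refl

  residue : ∀ a → a ≈ + (a ℤ.%ℕ p)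
  residue a = ≈-trans (≈-reflexive (trans (a≡a%ℕn+[a/ℕn]*n a p) (cong (λ m → + (a ℤ.%ℕ p) + m) (ℤP.*-comm (a ℤ./ℕ p) (+ p)))))
                      (+-multiple _ (a ℤ./ℕ p))

  larger≉ : ∀ {m n} → m ℕ.< n → n ℕ.< p → ¬ + n ≈ + m
  larger≉ {m} {n} m<n n<p n≈m =
    nonzero (ℕP.m<n⇒0<n∸m m<n) (ℕP.≤-<-trans (ℕP.m∸n≤m n m) n<p)
            (≈-trans (≈-reflexive (sym (pos-difference (ℕP.<⇒≤ m<n)))) (≈⇒-≈0 n≈m))

  residue-unique : ∀ {m n} → m ℕ.< p → n ℕ.< p → + m ≈ + n → m ≡ n
  residue-unique {m} {n} m<p n<p m≈n with ℕP.<-cmp m n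
  ... | tri< m<n _ _ = contradiction (≈-sym m≈n) (larger≉ m<n n<p)
  ... | tri≈ _ m≡n _ = m≡n
  ... | tri> _ _ n<m = contradiction m≈n (larger≉ n<m m<p)

  residue≈ : ∀ {a r} → a ℤ.%ℕ p ≡ r → a ≈ + r
  residue≈ {a} a%p = ≈-trans (residue a) (≈-reflexive (cong +_ a%p))

  residue≉0 : ∀ {a r} → a ℤ.%ℕ p ≡ suc r → ¬ a ≈ + 0
  residue≉0 {a} a%p a≈0 = nonzero (s≤s z≤n) (subst (ℕ._< p) a%p (n%ℕd<d a p)) (≈-trans (≈-sym (residue≈ a%p)) a≈0)

  euler-zero : ∀ {a} → a ≈ + 0 → a ^ h ≈ + 0
  euler-zero {a} a≈0 = ≈-trans (^-cong h a≈0) (≈-reflexive (cong ((+ 0) ^_) (sym h≡suc[pred[h]])))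

  euler-residue : ∀ {a} y → ¬ a ≈ + 0 → a ≈ + (y ℕ.* y) → a ^ h ≈ + 1
  euler-residue {a} y a≉0 a≈y² = ≈-trans (^-cong h a≈y²) (square-power y y≉0)
    where
    y≉0 : ¬ + y ≈ + 0
    y≉0 y≈0 = a≉0 (≈-trans a≈y² (≈-trans (≈-reflexive (ℤP.pos-* y y)) (*-cong y≈0 (≈-refl {+ y}))))

  euler-nonresidue : ∀ {a} → ¬ a ≈ + 0 → (∀ {y} → 0 ℕ.< y → y ℕ.≤ h → ¬ a ≈ + (y ℕ.* y)) → a ^ h ≈ -[1+ 0 ]
  euler-nonresidue {a} a≉0 nonsquare =
    [ (λ aʰ-1≈0 → ⊥-elim (power≈1⇒square (-≈0⇒≈ aʰ-1≈0) nonsquare)) , aʰ≈-1 ]′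
      (euclid (a ^ h - + 1) (a ^ h + + 1) product≈0)
    where
    factor : ∀ b → (b - + 1) * (b + + 1) ≡ b * b - + 1
    factor = solve-∀
    product≈0 : (a ^ h - + 1) * (a ^ h + + 1) ≈ + 0
    product≈0 = ≈-trans (≈-reflexive (trans (factor (a ^ h)) (cong (_- + 1) (sym (ℤP.^-distribˡ-+-* a h h)))))
                        (≈⇒-≈0 (fermat-unit a a≉0))
    shift : ∀ b → b ≡ (b + + 1) - + 1
    shift = solve-∀
    aʰ≈-1 : a ^ h + + 1 ≈ + 0 → a ^ h ≈ -[1+ 0 ]
    aʰ≈-1 aʰ+1≈0 = ≈-trans (≈-reflexive (shift (a ^ h))) (-‿cong aʰ+1≈0 (≈-refl {+ 1}))

  -- The test performed by legendre: is y² ≡ s (mod p)?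
  squareHits : ℕ → ℕ → Bool
  squareHits s y = ⌊ (y ℕ.* y) ℕ.% p ℕ.≟ s ⌋

  euler : ∀ a → a ^ h ≈ legendre a p
  euler a with a ℤ.%ℕ suc (h ℕ.+ h) in a%p
  ... | zero = euler-zero (residue≈ a%p)
  ... | suc r with any (λ y → ⌊ (y ℕ.* y) ℕ.% p ℕ.≟ suc r ⌋) (upTo p) in search
  ...   | true  = euler-residue y (residue≉0 a%p) (≈-trans (residue≈ a%p) (≈-sym (residue≈ y²%p)))
    where
    witness = Any.satisfied (any⁻ (squareHits (suc r)) (upTo p) (subst T (sym search) tt))
    y = proj₁ witness
    y²%p : (y ℕ.* y) ℕ.% p ≡ suc r
    y²%p = toWitness (proj₂ witness)
  ...   | false = euler-nonresidue (residue≉0 a%p) nonsquare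
    where
    nonsquare : ∀ {y} → 0 ℕ.< y → y ℕ.≤ h → ¬ a ≈ + (y ℕ.* y)
    nonsquare {y} _ y≤h a≈y² = subst T search (any⁺ (squareHits (suc r)) (lose (∈-upTo⁺ (≤h⇒<p y≤h)) (fromWitness y²%p)))
      where
      y²%p : (y ℕ.* y) ℕ.% p ≡ suc r
      y²%p = residue-unique (m%n<n (y ℕ.* y) p) (subst (ℕ._< p) a%p (n%ℕd<d a p))
               (≈-trans (≈-sym (residue (+ (y ℕ.* y)))) (≈-trans (≈-sym a≈y²) (residue≈ a%p)))

odd-prime-form : ∀ {p} → Prime p → p ≢ 2 → ∃[ h ] p ≡ suc (h ℕ.+ h)
odd-prime-form {p} isPrime p≢2 = from-remainder (p ℕ.% 2) refl (m%n<n p 2)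
  where
  from-remainder : ∀ r → p ℕ.% 2 ≡ r → r ℕ.< 2 → ∃[ h ] p ≡ suc (h ℕ.+ h)
  from-remainder zero          p%2≡0 _ =
    contradiction (composite-≢ 2 {{_}} {{prime⇒nonZero isPrime}} (λ 2≡p → p≢2 (sym 2≡p)) (m%n≡0⇒n∣m p 2 p%2≡0))
                  (prime⇒¬composite isPrime)
  from-remainder (suc zero)    p%2≡1 _ = p ℕ./ 2 , trans (m≡m%n+[m/n]*n p 2) (cong₂ ℕ._+_ p%2≡1 (double (p ℕ./ 2)))
    where
    double : ∀ q → q ℕ.* 2 ≡ q ℕ.+ q
    double q = trans (ℕP.*-comm q 2) (cong (q ℕ.+_) (ℕP.+-identityʳ q))
  from-remainder (suc (suc _)) _ (s≤s (s≤s ()))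

corollary1p1 : (p : ℕ) → Prime p → p ≢ 2 →
    ((x : ℤ) → (+ p) ∣ (Σ≤ (p ∸ 1) (λ k → D k x * D k x) - legendre (x * (x + + 1)) p))
    × ((+ p) ∣ (Σ≤ (p ∸ 1) (λ k → D k (+ 1) * D k (+ 1)) - legendre (+ 2) p))
corollary1p1 p isPrime p≢2 with odd-prime-form isPrime p≢2
... | h , refl = congruence , congruence (+ 1)
  where
  open OddPrime h isPrime using (≈-trans; difference; sum-of-squares; euler)
  congruence : ∀ x → (+ p) ∣ (Σ≤ (p ∸ 1) (λ k → D k x * D k x) - legendre (x * (x + + 1)) p)
  congruence x = Signed.∣⇒∣ᵤ (difference (≈-trans (sum-of-squares x) (euler (x * (x + + 1)))))
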